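{- For every $f:\{0,1\}^n\to\{0,1\}$, $\mathbf{I}[f]\le\mathsf{alt}(f)\cdot\deg_2(f)^2$.
   Context: The influence is $\mathbf{I}[f]=\mathbb{E}_{x}[\mathsf{s}(f,x)]$ for $x$ uniform on $\{0,1\}^n$, where $\mathsf{s}(f,x)=|\{i: f(x\oplus e_i)\ne f(x)\}|$. $\deg_2(f)$ is the $\mathbb{F}_2$-degree of $f$. $\mathsf{alt}(f)$ is the maximum, over chains $0^n=x_0\prec\dots\prec x_n=1^n$ of distinct inputs (coordinatewise order), of the number of $i$ with $f(x_{i-1})\ne f(x_i)$. -}

module Defs where

open import Data.Bool using (Bool; true; false; not; _∧_; _xor_; if_then_else_)
open import Data.Nat using (ℕ; zero; suc; _+_; _*_; _^_; _≤_; _<_)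
open import Data.Nat.Properties using (m^n≢0)
open import Data.Fin using (Fin; inject₁; fromℕ)
import Data.Fin as F
open import Data.Vec using (Vec; []; _∷_; replicate; updateAt; lookup)
open import Data.List using (List; []; _∷_; map; _++_; foldr; length; filter)
open import Data.Nat.ListAction using (sum)
open import Data.Product using (Σ; ∃; _×_; _,_)
open import Relation.Binary.PropositionalEquality using (_≡_; _≢_)
open import Relation.Nullary using (¬_)
open import Data.Integer using (+_)
open import Data.Rational using (ℚ; _/_)

-- Points of the hypercube {0,1}^n (false = 0, true = 1).
Cube : ℕ → Set
Cube n = Vec Bool n

BoolFun : ℕ → Set
BoolFun n = Cube n → Bool

allCube : (n : ℕ) → List (Cube n)
allCube zero    = [] ∷ []
allCube (suc n) = map (false ∷_) (allCube n) ++ map (true ∷_) (allCube n)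

countFin : (n : ℕ) → (Fin n → Bool) → ℕ
countFin zero    p = 0
countFin (suc n) p = (if p F.zero then 1 else 0) + countFin n (λ i → p (F.suc i))

_≠ᵇ_ : Bool → Bool → Bool
a ≠ᵇ b = a xor b

flip : {n : ℕ} → Cube n → Fin n → Cube n
flip x i = updateAt x i not

sensitivity : {n : ℕ} → BoolFun n → Cube n → ℕ
sensitivity {n} f x = countFin n (λ i → f (flip x i) ≠ᵇ f x)

totalSensitivity : {n : ℕ} → BoolFun n → ℕ
totalSensitivity {n} f = sum (map (sensitivity f) (allCube n))

influence : {n : ℕ} → BoolFun n → ℚ
influence {n} f = (+ totalSensitivity f) / (2 ^ n)
  where instance _ = m^n≢0 2 n

data _≤ᵇ_ : Bool → Bool → Set where
  f≤b : ∀ {b} → false ≤ᵇ b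
  t≤t : true ≤ᵇ true

_≼_ : {n : ℕ} → Cube n → Cube n → Set
_≼_ {n} x y = (i : Fin n) → lookup x i ≤ᵇ lookup y i

_≺_ : {n : ℕ} → Cube n → Cube n → Set
x ≺ y = x ≼ y × x ≢ y

-- A multilinear F₂-polynomial in n variables is given by its coefficient
-- function c : (monomials = subsets S ⊆ [n], encoded as indicator vectors) → F₂.
-- Its value at x is  ⊕_{S} c(S) · ∏_{i ∈ S} x_i, and ∏_{i∈S} x_i = 1 iff S ⊆ x.

Poly : ℕ → Set
Poly n = Cube n → Bool

subsetᵇ : {n : ℕ} → Cube n → Cube n → Bool
subsetᵇ []       []       = true
subsetᵇ (s ∷ ss) (x ∷ xs) = (if s then x else true) ∧ subsetᵇ ss xs

xorList : List Bool → Bool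
xorList = foldr _xor_ false

evalPoly : {n : ℕ} → Poly n → Cube n → Bool
evalPoly {n} c x = xorList (map (λ S → c S ∧ subsetᵇ S x) (allCube n))

weight : {n : ℕ} → Cube n → ℕ
weight []           = 0
weight (true ∷ s)   = suc (weight s)
weight (false ∷ s)  = weight s

PolyDegLe : {n : ℕ} → Poly n → ℕ → Set
PolyDegLe {n} c d = (S : Cube n) → c S ≡ true → weight S ≤ d

Deg₂Le : {n : ℕ} → BoolFun n → ℕ → Set
Deg₂Le {n} f d = Σ (Poly n) λ c → ((x : Cube n) → evalPoly c x ≡ f x) × PolyDegLe c d

IsDeg₂ : {n : ℕ} → BoolFun n → ℕ → Set
IsDeg₂ f d = Deg₂Le f d × ((d' : ℕ) → Deg₂Le f d' → d ≤ d')

record Chain (n : ℕ) : Set where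
  field
    pt     : Fin (suc n) → Cube n
    start  : pt F.zero ≡ replicate n false
    end    : pt (fromℕ n) ≡ replicate n true
    strict : (i : Fin n) → pt (inject₁ i) ≺ pt (F.suc i)

alternations : {n : ℕ} → BoolFun n → Chain n → ℕ
alternations {n} f ch = countFin n (λ i → f (Chain.pt ch (inject₁ i)) ≠ᵇ f (Chain.pt ch (F.suc i)))

IsAlt : {n : ℕ} → BoolFun n → ℕ → Set
IsAlt {n} f a = (Σ (Chain n) λ ch → alternations f ch ≡ a) × ((ch : Chain n) → alternations f ch ≤ a)

module Submission where

-- We show the pointwise bound s(f,x) ≤ d · a for every input x, where d = deg₂(f)
-- and a = alt(f); averaging over the cube and d ≤ d² then give I[f] ≤ a · d².  Lowering the down-sensitive coordinates of x gives b ⊑ x, raising the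
-- up-sensitive ones gives t ⊒ x, and s(f,x) = |t| − |b|.  The engine is a parity fact:
-- a polynomial of degree ≤ d sums to zero over every subcube of dimension > d.  So if
-- f(y) ≠ f(t) on a large interval [y,t], another point of it still disagrees with t;
-- iterating, some B ∈ [y,t] within distance d of t disagrees with t.  Peeling off such
-- segments, each of length ≤ d and costing one change of value, yields a monotone walk
-- x → t with |t| − |x| ≤ d · (changes of f along it), and dually a walk b → x.  The walk
-- b → x → t extends to a maximal chain of the cube, so it changes value at most a times.

open import Defs
open import Data.Nat using (ℕ; _*_; _^_)
open import Data.Nat.Properties using (m^n≢0)
open import Data.Integer using (+_)
open import Data.Product using (_,_)

-- The development lives in its own module because it uses the order on ℕ, whereas the
-- statement of the theorem uses the order on ℚ under the same name _≤_.
module SensitivityBound where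
  open import Algebra.Bundles using (CommutativeRing)
  open import Data.Bool using (Bool; true; false; not; _∧_; _xor_; if_then_else_)
  import Data.Bool as Bool
  open import Data.Bool.Properties
    using (xor-assoc; xor-same; xor-identityʳ; xor-∧-commutativeRing)
  open import Algebra.Properties.CommutativeSemigroup
    (CommutativeRing.+-commutativeSemigroup xor-∧-commutativeRing)
    using () renaming (interchange to xor-interchange)
  open import Data.Nat using (zero; suc; _+_; _≤_; _<_; z≤n; _≤?_; NonZero)
  open import Data.Nat.Properties
    using ( ≤-refl; ≤-reflexive; ≤-trans; ≤-<-trans; <⇒≤; ≤-pred; ≰⇒>
          ; m≤m+n; m≤n+m; +-comm; +-assoc; +-suc; +-identityʳ; +-mono-≤
          ; *-identityʳ; *-comm; *-distribˡ-+; *-monoʳ-≤; *-monoˡ-≤; m≤m*n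
          ; module ≤-Reasoning )
  open import Data.Nat.ListAction using (sum)
  open import Data.Fin using (Fin; inject₁; fromℕ) renaming (zero to fzero; suc to fsuc)
  open import Data.Vec using ([]; _∷_; replicate)
  open import Data.Vec.Properties using (∷-injectiveʳ)
  open import Data.Vec.Relation.Binary.Pointwise.Inductive as Pw using (Pointwise; []; _∷_)
  open import Data.List using (List; []; _∷_; map; _++_; length; [_])
  open import Data.List.Properties using (map-++; ++-assoc; map-∘; map-cong; length-map; length-++)
  open import Data.List.Relation.Unary.All as All using (All; []; _∷_)
  open import Data.List.Relation.Unary.All.Properties using (map⁺; ++⁺; ++⁻ˡ)
  open import Data.Product using (∃; ∃₂; _×_; _,_)
  open import Data.Sum as Sum using (_⊎_; inj₁; inj₂)
  open import Function using (_∘_)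
  open import Relation.Binary.PropositionalEquality hiding ([_])
  open import Relation.Nullary using (yes; no; contradiction)
  import Data.Integer as ℤ
  import Data.Integer.Properties as ℤ
  import Data.Rational as ℚ
  import Data.Rational.Properties as ℚ
  import Data.Rational.Unnormalised as ℚᵘ
  import Data.Rational.Unnormalised.Properties as ℚᵘ

  private
    variable
      n k l : ℕ
      u v x y z : Cube n

  ≠ᵇ⇒≢ : ∀ a b → a ≠ᵇ b ≡ true → a ≢ b
  ≠ᵇ⇒≢ false true  _ ()
  ≠ᵇ⇒≢ true  false _ ()

  ≢⇒≠ᵇ : ∀ a b → a ≢ b → a ≠ᵇ b ≡ true
  ≢⇒≠ᵇ false false ne = contradiction refl ne
  ≢⇒≠ᵇ false true  _  = refl
  ≢⇒≠ᵇ true  false _  = refl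
  ≢⇒≠ᵇ true  true  ne = contradiction refl ne

  xor≡false⇒≡ : ∀ a b → a xor b ≡ false → a ≡ b
  xor≡false⇒≡ false false _ = refl
  xor≡false⇒≡ true  true  _ = refl

  change : Bool → Bool → ℕ
  change a b = if a ≠ᵇ b then 1 else 0

  change-pos : ∀ {a b} → a ≢ b → 1 ≤ change a b
  change-pos {a} {b} ne rewrite ≢⇒≠ᵇ a b ne = ≤-refl

  _⊑_ : Cube n → Cube n → Set
  _⊑_ = Pointwise _≤ᵇ_

  ≤ᵇ-refl : ∀ {a} → a ≤ᵇ a
  ≤ᵇ-refl {false} = f≤b
  ≤ᵇ-refl {true}  = t≤t

  ≤ᵇ-trans : ∀ {a b c} → a ≤ᵇ b → b ≤ᵇ c → a ≤ᵇ c
  ≤ᵇ-trans f≤b _   = f≤b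
  ≤ᵇ-trans t≤t t≤t = t≤t

  ⊑-refl : x ⊑ x
  ⊑-refl = Pw.refl ≤ᵇ-refl

  ⊑-trans : x ⊑ y → y ⊑ z → x ⊑ z
  ⊑-trans = Pw.trans ≤ᵇ-trans

  bottom-⊑ : ∀ (x : Cube n) → replicate n false ⊑ x
  bottom-⊑ []      = []
  bottom-⊑ (_ ∷ x) = f≤b ∷ bottom-⊑ x

  ⊑-top : ∀ (x : Cube n) → x ⊑ replicate n true
  ⊑-top []          = []
  ⊑-top (false ∷ x) = f≤b ∷ ⊑-top x
  ⊑-top (true ∷ x)  = t≤t ∷ ⊑-top x

  -- gap x y counts the coordinates that are 0 in x and 1 in y; for x ⊑ y it is the
  -- dimension of the subcube [x, y], i.e. |y| − |x|.
  gap : Cube n → Cube n → ℕ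
  gap []          []          = 0
  gap (false ∷ x) (false ∷ y) = gap x y
  gap (false ∷ x) (true ∷ y)  = suc (gap x y)
  gap (true ∷ x)  (_ ∷ y)     = gap x y

  gap-refl : ∀ (x : Cube n) → gap x x ≡ 0
  gap-refl []          = refl
  gap-refl (false ∷ x) = gap-refl x
  gap-refl (true ∷ x)  = gap-refl x

  gap-trans : x ⊑ y → y ⊑ z → gap x z ≡ gap x y + gap y z
  gap-trans []                []                = refl
  gap-trans (f≤b {false} ∷ p) (f≤b {false} ∷ q) = gap-trans p q
  gap-trans (f≤b {false} ∷ p) (f≤b {true} ∷ q)  = trans (cong suc (gap-trans p q)) (sym (+-suc _ _))
  gap-trans (f≤b {true} ∷ p)  (t≤t ∷ q)         = cong suc (gap-trans p q)
  gap-trans (t≤t ∷ p)         (t≤t ∷ q)         = gap-trans p q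

  gap-bottom-top : ∀ n → gap (replicate n false) (replicate n true) ≡ n
  gap-bottom-top zero    = refl
  gap-bottom-top (suc n) = cong suc (gap-bottom-top n)

  data _⋖_ : Cube n → Cube n → Set where
    here  : (false ∷ x) ⋖ (true ∷ x)
    there : ∀ {a} → x ⋖ y → (a ∷ x) ⋖ (a ∷ y)

  ⋖⇒⊑ : x ⋖ y → x ⊑ y
  ⋖⇒⊑ here      = f≤b ∷ ⊑-refl
  ⋖⇒⊑ (there c) = ≤ᵇ-refl ∷ ⋖⇒⊑ c

  ⋖-gap : x ⋖ y → gap x y ≡ 1
  ⋖-gap (here {x = x})        = cong suc (gap-refl x)
  ⋖-gap (there {a = false} c) = ⋖-gap c
  ⋖-gap (there {a = true} c)  = ⋖-gap c

  ⋖⇒≢ : x ⋖ y → x ≢ y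
  ⋖⇒≢ here      ()
  ⋖⇒≢ (there c) = ⋖⇒≢ c ∘ ∷-injectiveʳ

  ⋖⇒≺ : x ⋖ y → x ≺ y
  ⋖⇒≺ c = Pw.lookup (⋖⇒⊑ c) , ⋖⇒≢ c

  cover-above : x ⊑ y → x ≡ y ⊎ ∃ λ z → x ⋖ z × z ⊑ y
  cover-above []                = inj₁ refl
  cover-above (f≤b {true} ∷ p)  = inj₂ (_ , here , t≤t ∷ p)
  cover-above (f≤b {false} ∷ p) =
    Sum.map (cong (false ∷_)) (λ { (z , c , q) → false ∷ z , there c , f≤b ∷ q }) (cover-above p)
  cover-above (t≤t ∷ p)         =
    Sum.map (cong (true ∷_)) (λ { (z , c , q) → true ∷ z , there c , t≤t ∷ q }) (cover-above p)

  cover-below : x ⊑ y → x ≡ y ⊎ ∃ λ z → x ⊑ z × z ⋖ y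
  cover-below []                = inj₁ refl
  cover-below (f≤b {true} ∷ p)  = inj₂ (_ , f≤b ∷ p , here)
  cover-below (f≤b {false} ∷ p) =
    Sum.map (cong (false ∷_)) (λ { (z , q , c) → false ∷ z , f≤b ∷ q , there c }) (cover-below p)
  cover-below (t≤t ∷ p)         =
    Sum.map (cong (true ∷_)) (λ { (z , q , c) → true ∷ z , t≤t ∷ q , there c }) (cover-below p)

  gap-pos : x ⊑ y → x ≢ y → 1 ≤ gap x y
  gap-pos {x = x} {y = y} le ne with cover-above le
  ... | inj₁ eq          = contradiction eq ne
  ... | inj₂ (z , c , q) = begin
    1                 ≡⟨ sym (⋖-gap c) ⟩
    gap x z           ≤⟨ m≤m+n _ _ ⟩
    gap x z + gap z y ≡⟨ sym (gap-trans (⋖⇒⊑ c) q) ⟩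
    gap x y           ∎
    where open ≤-Reasoning

  drop-positive : ∀ {a b} → 1 ≤ a → a + b ≤ suc k → b ≤ k
  drop-positive {a = suc a} {b} _ le = ≤-trans (m≤n+m b a) (≤-pred le)

  gap-drop-lower : x ⊑ y → y ⊑ z → x ≢ y → gap x z ≤ suc k → gap y z ≤ k
  gap-drop-lower xy yz ne le =
    drop-positive (gap-pos xy ne) (subst (_≤ _) (gap-trans xy yz) le)

  gap-drop-upper : x ⊑ y → y ⊑ z → y ≢ z → gap x z ≤ suc k → gap x y ≤ k
  gap-drop-upper {x = x} {y = y} {z = z} xy yz ne le =
    drop-positive (gap-pos yz ne) (subst (_≤ _) (trans (gap-trans xy yz) (+-comm (gap x y) (gap y z))) le)

  data Walk {n : ℕ} : Cube n → Cube n → ℕ → Set where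
    done : Walk u u 0
    step : u ⋖ v → Walk v y k → Walk u y (suc k)

  _++ʷ_ : Walk u v k → Walk v y l → Walk u y (k + l)
  done     ++ʷ w′ = w′
  step c w ++ʷ w′ = step c (w ++ʷ w′)

  walk-⊑ : Walk u v k → u ⊑ v
  walk-⊑ done       = ⊑-refl
  walk-⊑ (step c w) = ⊑-trans (⋖⇒⊑ c) (walk-⊑ w)

  walk-length : Walk u v k → k ≡ gap u v
  walk-length {u = u} done = sym (gap-refl u)
  walk-length {u = u} {v = v} (step {v = u′} c w) = begin
    suc _               ≡⟨ cong suc (walk-length w) ⟩
    1 + gap u′ v        ≡⟨ cong (_+ gap u′ v) (sym (⋖-gap c)) ⟩
    gap u u′ + gap u′ v ≡⟨ sym (gap-trans (⋖⇒⊑ c) (walk-⊑ w)) ⟩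
    gap u v             ∎
    where open ≡-Reasoning

  lift : ∀ a → Walk u v k → Walk (a ∷ u) (a ∷ v) k
  lift a done       = done
  lift a (step c w) = step (there c) (lift a w)

  walk : u ⊑ v → ∃ (Walk u v)
  walk []                = 0 , done
  walk (f≤b {false} ∷ p) = let k , w = walk p in k , lift false w
  walk (f≤b {true} ∷ p)  = let k , w = walk p in suc k , step here (lift true w)
  walk (t≤t ∷ p)         = let k , w = walk p in k , lift true w

  points : {u v : Cube n} → Walk u v k → Fin (suc k) → Cube n
  points {u = u} w          fzero    = u
  points         (step _ w) (fsuc i) = points w i

  points-end : (w : Walk u v k) → points w (fromℕ k) ≡ v
  points-end done       = refl
  points-end (step _ w) = points-end w

  points-step : (w : Walk u v k) (i : Fin k) → points w (inject₁ i) ⋖ points w (fsuc i)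
  points-step (step c w) fzero    = c
  points-step (step c w) (fsuc i) = points-step w i

  module _ (f : BoolFun n) where

    changes : {u v : Cube n} → Walk u v k → ℕ
    changes done                        = 0
    changes (step {u = u} {v = u′} _ w) = change (f u) (f u′) + changes w

    changes-++ : {u v y : Cube n} (w : Walk u v k) (w′ : Walk v y l) →
      changes (w ++ʷ w′) ≡ changes w + changes w′
    changes-++ done                        w′ = refl
    changes-++ (step {u = u} {v = u′} c w) w′ =
      trans (cong (_+_ (change (f u) (f u′))) (changes-++ w w′)) (sym (+-assoc (change (f u) (f u′)) _ _))

    changes-pos : {u v : Cube n} (w : Walk u v k) → f u ≢ f v → 1 ≤ changes w
    changes-pos done ne = contradiction refl ne
    changes-pos (step {u = u} {v = u′} _ w) ne with f u Bool.≟ f u′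
    ... | yes eq = ≤-trans (changes-pos w (ne ∘ trans eq)) (m≤n+m _ _)
    ... | no ne′ = ≤-trans (change-pos ne′) (m≤m+n _ _)

    changes-points : {u v : Cube n} (w : Walk u v k) →
      countFin k (λ i → f (points w (inject₁ i)) ≠ᵇ f (points w (fsuc i))) ≡ changes w
    changes-points done                        = refl
    changes-points (step {u = u} {v = u′} _ w) = cong (_+_ (change (f u) (f u′))) (changes-points w)

  chain : Walk (replicate n false) (replicate n true) k → k ≡ n → Chain n
  chain w refl = record
    { pt = points w ; start = refl ; end = points-end w ; strict = ⋖⇒≺ ∘ points-step w }

  alternations-chain : (f : BoolFun n) (w : Walk (replicate n false) (replicate n true) k) (e : k ≡ n) →
    alternations f (chain w e) ≡ changes f w
  alternations-chain f w refl = changes-points f w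

  -- Any walk extends to a walk through the whole cube, so it changes value at most alt(f) times.
  changes-≤-alt : (f : BoolFun n) {a : ℕ} → ((ch : Chain n) → alternations f ch ≤ a) →
    {u v : Cube n} (w : Walk u v k) → changes f w ≤ a
  changes-≤-alt {n = n} {k = k} f {a} maxAlt {u} {v} w with walk (bottom-⊑ u) | walk (⊑-top v)
  ... | k₋ , w₋ | k₊ , w₊ = begin
    changes f w                            ≤⟨ m≤m+n _ _ ⟩
    changes f w + changes f w₊             ≡⟨ sym (changes-++ f w w₊) ⟩
    changes f (w ++ʷ w₊)                   ≤⟨ m≤n+m _ _ ⟩
    changes f w₋ + changes f (w ++ʷ w₊)    ≡⟨ sym (changes-++ f w₋ (w ++ʷ w₊)) ⟩
    changes f W                            ≡⟨ sym (alternations-chain f W full) ⟩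
    alternations f (chain W full)          ≤⟨ maxAlt (chain W full) ⟩
    a                                      ∎
    where
    open ≤-Reasoning
    W : Walk (replicate n false) (replicate n true) (k₋ + (k + k₊))
    W = w₋ ++ʷ (w ++ʷ w₊)
    full : k₋ + (k + k₊) ≡ n
    full = trans (walk-length W) (gap-bottom-top n)

  up : BoolFun n → Cube n → Cube n
  up g []          = []
  up g (false ∷ x) = (g (true ∷ x) ≠ᵇ g (false ∷ x)) ∷ up (g ∘ (false ∷_)) x
  up g (true ∷ x)  = true ∷ up (g ∘ (true ∷_)) x

  down : BoolFun n → Cube n → Cube n
  down g []          = []
  down g (false ∷ x) = false ∷ down (g ∘ (false ∷_)) x
  down g (true ∷ x)  = not (g (false ∷ x) ≠ᵇ g (true ∷ x)) ∷ down (g ∘ (true ∷_)) x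

  ⊑-up : ∀ (g : BoolFun n) x → x ⊑ up g x
  ⊑-up g []          = []
  ⊑-up g (false ∷ x) = f≤b ∷ ⊑-up (g ∘ (false ∷_)) x
  ⊑-up g (true ∷ x)  = t≤t ∷ ⊑-up (g ∘ (true ∷_)) x

  down-⊑ : ∀ (g : BoolFun n) x → down g x ⊑ x
  down-⊑ g []          = []
  down-⊑ g (false ∷ x) = f≤b ∷ down-⊑ (g ∘ (false ∷_)) x
  down-⊑ g (true ∷ x) with g (false ∷ x) ≠ᵇ g (true ∷ x)
  ... | true  = f≤b ∷ down-⊑ (g ∘ (true ∷_)) x
  ... | false = t≤t ∷ down-⊑ (g ∘ (true ∷_)) x

  -- s(g, x) = gap (down g x) x + gap x (up g x): each sensitive coordinate is moved once.
  sensitivity-split : ∀ (g : BoolFun n) x → sensitivity g x ≡ gap (down g x) x + gap x (up g x)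
  sensitivity-split g [] = refl
  sensitivity-split g (false ∷ x) with g (true ∷ x) ≠ᵇ g (false ∷ x)
  ... | false = sensitivity-split (g ∘ (false ∷_)) x
  ... | true  = trans (cong suc (sensitivity-split (g ∘ (false ∷_)) x)) (sym (+-suc _ _))
  sensitivity-split g (true ∷ x) with g (false ∷ x) ≠ᵇ g (true ∷ x)
  ... | false = sensitivity-split (g ∘ (true ∷_)) x
  ... | true  = cong suc (sensitivity-split (g ∘ (true ∷_)) x)

  UpSensitive : BoolFun n → Cube n → Cube n → Set
  UpSensitive {n} g x t = ∀ {y : Cube n} → x ⋖ y → y ⊑ t → g y ≢ g x

  DownSensitive : BoolFun n → Cube n → Cube n → Set
  DownSensitive {n} g b x = ∀ {y : Cube n} → y ⋖ x → b ⊑ y → g y ≢ g x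

  up-sensitive : ∀ (g : BoolFun n) x → UpSensitive g x (up g x)
  up-sensitive g []          ()
  up-sensitive g (false ∷ x) here (_ ∷ _) with g (true ∷ x) ≠ᵇ g (false ∷ x) in sens
  up-sensitive g (false ∷ x) here (() ∷ _) | false
  up-sensitive g (false ∷ x) here (_ ∷ _)  | true = ≠ᵇ⇒≢ _ _ sens
  up-sensitive g (false ∷ x) (there c) (_ ∷ p) = up-sensitive (g ∘ (false ∷_)) x c p
  up-sensitive g (true ∷ x)  (there c) (_ ∷ p) = up-sensitive (g ∘ (true ∷_)) x c p

  down-sensitive : ∀ (g : BoolFun n) x → DownSensitive g (down g x) x
  down-sensitive g []         ()
  down-sensitive g (true ∷ x) here (_ ∷ _) with g (false ∷ x) ≠ᵇ g (true ∷ x) in sens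
  down-sensitive g (true ∷ x) here (() ∷ _) | false
  down-sensitive g (true ∷ x) here (_ ∷ _)  | true = ≠ᵇ⇒≢ _ _ sens
  down-sensitive g (false ∷ x) (there c) (_ ∷ p) = down-sensitive (g ∘ (false ∷_)) x c p
  down-sensitive g (true ∷ x)  (there c) (_ ∷ p) = down-sensitive (g ∘ (true ∷_)) x c p

  parity : ∀ {A : Set} → (A → Bool) → List A → Bool
  parity h L = xorList (map h L)

  module _ {A : Set} where

    parity-++ : ∀ (h : A → Bool) L M → parity h (L ++ M) ≡ parity h L xor parity h M
    parity-++ h []      M = refl
    parity-++ h (a ∷ L) M = trans (cong (h a xor_) (parity-++ h L M)) (sym (xor-assoc (h a) _ _))

    parity-map : ∀ {B : Set} (h : B → Bool) (g : A → B) L → parity h (map g L) ≡ parity (h ∘ g) L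
    parity-map h g L = cong xorList (sym (map-∘ L))

    parity-cong : ∀ {g h : A → Bool} → (∀ a → g a ≡ h a) → ∀ L → parity g L ≡ parity h L
    parity-cong e L = cong xorList (map-cong e L)

    parity-false : ∀ L → parity (λ (_ : A) → false) L ≡ false
    parity-false []      = refl
    parity-false (_ ∷ L) = parity-false L

    parity-xor : ∀ (g h : A → Bool) L → parity (λ a → g a xor h a) L ≡ parity g L xor parity h L
    parity-xor g h []      = refl
    parity-xor g h (a ∷ L) =
      trans (cong ((g a xor h a) xor_) (parity-xor g h L)) (xor-interchange (g a) (h a) _ _)

    parity-swap : ∀ {B : Set} (h : A → B → Bool) L (M : List B) →
      parity (λ b → parity (λ a → h a b) L) M ≡ parity (λ a → parity (h a) M) L
    parity-swap h L []      = sym (parity-false L)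
    parity-swap h L (b ∷ M) =
      trans (cong (parity (λ a → h a b) L xor_) (parity-swap h L M))
            (sym (parity-xor (λ a → h a b) (λ a → parity (h a) M) L))

    odd-witness : ∀ {P : A → Set} {h : A → Bool} {L} → All P L → parity h L ≡ true →
      ∃ λ a → P a × h a ≡ true
    odd-witness {h = h} {a ∷ _} (p ∷ ps) odd with h a in ha
    ... | true  = a , p , ha
    ... | false = odd-witness ps odd

  -- The points of the subcube [x, y], listed (empty unless x ⊑ y).
  interval : Cube n → Cube n → List (Cube n)
  interval []          []          = [ [] ]
  interval (false ∷ x) (false ∷ y) = map (false ∷_) (interval x y)
  interval (false ∷ x) (true ∷ y)  = map (false ∷_) (interval x y) ++ map (true ∷_) (interval x y)
  interval (true ∷ x)  (false ∷ y) = []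
  interval (true ∷ x)  (true ∷ y)  = map (true ∷_) (interval x y)

  interval-⊑ : ∀ (x y : Cube n) → All (λ w → x ⊑ w × w ⊑ y) (interval x y)
  interval-⊑ []          []          = ([] , []) ∷ []
  interval-⊑ (false ∷ x) (false ∷ y) =
    map⁺ (All.map (λ { (p , q) → f≤b ∷ p , f≤b ∷ q }) (interval-⊑ x y))
  interval-⊑ (false ∷ x) (true ∷ y)  =
    ++⁺ (map⁺ (All.map (λ { (p , q) → f≤b ∷ p , f≤b ∷ q }) (interval-⊑ x y)))
        (map⁺ (All.map (λ { (p , q) → f≤b ∷ p , t≤t ∷ q }) (interval-⊑ x y)))
  interval-⊑ (true ∷ x)  (false ∷ y) = []
  interval-⊑ (true ∷ x)  (true ∷ y)  =
    map⁺ (All.map (λ { (p , q) → t≤t ∷ p , t≤t ∷ q }) (interval-⊑ x y))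

  interval-head : x ⊑ y → ∃ λ rest → interval x y ≡ x ∷ rest × All (x ≢_) rest
  interval-head []                = [] , refl , []
  interval-head (f≤b {false} ∷ p) with interval-head p
  ... | rest , eq , ne = map (false ∷_) rest , cong (map (false ∷_)) eq ,
                         map⁺ (All.map (_∘ ∷-injectiveʳ) ne)
  interval-head {x = false ∷ x} {y = true ∷ y} (f≤b {true} ∷ p) with interval-head p
  ... | rest , eq , ne =
    map (false ∷_) rest ++ map (true ∷_) (interval x y) ,
    cong (λ L → map (false ∷_) L ++ map (true ∷_) (interval x y)) eq ,
    ++⁺ (map⁺ (All.map (_∘ ∷-injectiveʳ) ne)) (map⁺ (All.universal (λ _ ()) (interval x y)))
  interval-head (t≤t ∷ p) with interval-head p
  ... | rest , eq , ne = map (true ∷_) rest , cong (map (true ∷_)) eq ,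
                         map⁺ (All.map (_∘ ∷-injectiveʳ) ne)

  interval-last : ∀ {n} {x y : Cube n} → x ⊑ y → ∃ λ ini → interval x y ≡ ini ++ [ y ] × All (_≢ y) ini
  interval-last []                = [] , refl , []
  interval-last {y = false ∷ y} (f≤b {false} ∷ p) with interval-last p
  ... | ini , eq , ne = map (false ∷_) ini , trans (cong (map (false ∷_)) eq) (map-++ _ ini [ y ]) ,
                        map⁺ (All.map (_∘ ∷-injectiveʳ) ne)
  interval-last {n = suc m} {x = false ∷ x} {y = true ∷ y} (f≤b {true} ∷ p) with interval-last p
  ... | ini , eq , ne =
    map (false ∷_) (interval x y) ++ map (true ∷_) ini , listing ,
    ++⁺ (map⁺ (All.universal (λ _ ()) (interval x y))) (map⁺ (All.map (_∘ ∷-injectiveʳ) ne))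
    where
    open ≡-Reasoning
    F : List (Cube (suc m))
    F = map (false ∷_) (interval x y)
    listing : F ++ map (true ∷_) (interval x y) ≡ (F ++ map (true ∷_) ini) ++ [ true ∷ y ]
    listing = begin
      F ++ map (true ∷_) (interval x y)             ≡⟨ cong (λ L → F ++ map (true ∷_) L) eq ⟩
      F ++ map (true ∷_) (ini ++ [ y ])             ≡⟨ cong (F ++_) (map-++ (true ∷_) ini [ y ]) ⟩
      F ++ (map (true ∷_) ini ++ [ true ∷ y ])      ≡⟨ sym (++-assoc F _ _) ⟩
      (F ++ map (true ∷_) ini) ++ [ true ∷ y ]      ∎
  interval-last {y = true ∷ y} (t≤t ∷ p) with interval-last p
  ... | ini , eq , ne = map (true ∷_) ini , trans (cong (map (true ∷_)) eq) (map-++ _ ini [ y ]) ,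
                        map⁺ (All.map (_∘ ∷-injectiveʳ) ne)

  parity-interval-fixed : ∀ a (h : BoolFun (suc n)) (x y : Cube n) →
    parity h (interval (a ∷ x) (a ∷ y)) ≡ parity (h ∘ (a ∷_)) (interval x y)
  parity-interval-fixed false h x y = parity-map h (false ∷_) (interval x y)
  parity-interval-fixed true  h x y = parity-map h (true ∷_) (interval x y)

  parity-interval-free : ∀ (h : BoolFun (suc n)) (x y : Cube n) →
    parity h (interval (false ∷ x) (true ∷ y)) ≡
    parity (h ∘ (false ∷_)) (interval x y) xor parity (h ∘ (true ∷_)) (interval x y)
  parity-interval-free {n} h x y =
    trans (parity-++ h (map (false ∷_) I) (map (true ∷_) I)) (cong₂ _xor_ (parity-map h _ I) (parity-map h _ I))
    where
    I : List (Cube n)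
    I = interval x y

  -- A monomial of degree below the dimension of [x, y] sums to zero over [x, y]: some free
  -- coordinate of the interval does not occur in it, and the two halves cancel.
  monomial-parity : ∀ (S x y : Cube n) → weight S < gap x y → parity (subsetᵇ S) (interval x y) ≡ false
  monomial-parity []          []          []          ()
  monomial-parity (_ ∷ S)     (true ∷ x)  (false ∷ y) _  = refl
  monomial-parity (false ∷ S) (false ∷ x) (false ∷ y) lt =
    trans (parity-interval-fixed false _ x y) (monomial-parity S x y lt)
  monomial-parity (false ∷ S) (true ∷ x)  (true ∷ y)  lt =
    trans (parity-interval-fixed true _ x y) (monomial-parity S x y lt)
  monomial-parity (true ∷ S)  (false ∷ x) (false ∷ y) _  =
    trans (parity-interval-fixed false _ x y) (parity-false (interval x y))
  monomial-parity (true ∷ S)  (true ∷ x)  (true ∷ y)  lt =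
    trans (parity-interval-fixed true _ x y) (monomial-parity S x y (<⇒≤ lt))
  monomial-parity (false ∷ S) (false ∷ x) (true ∷ y)  _  =
    trans (parity-interval-free _ x y) (xor-same (parity (subsetᵇ S) (interval x y)))
  monomial-parity (true ∷ S)  (false ∷ x) (true ∷ y)  lt =
    trans (parity-interval-free _ x y)
          (cong₂ _xor_ (parity-false (interval x y)) (monomial-parity S x y (≤-pred lt)))

  empty-monomial : ∀ (w : Cube n) → subsetᵇ (replicate n false) w ≡ true
  empty-monomial []      = refl
  empty-monomial (_ ∷ w) = empty-monomial w

  weight-empty : ∀ n → weight (replicate n false) ≡ 0
  weight-empty zero    = refl
  weight-empty (suc n) = weight-empty n

  constant-parity : ∀ b (x y : Cube n) → 0 < gap x y → parity (λ _ → b) (interval x y) ≡ false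
  constant-parity false x y _   = parity-false (interval x y)
  constant-parity {n} true x y pos =
    trans (parity-cong (sym ∘ empty-monomial) (interval x y))
          (monomial-parity (replicate n false) x y (subst (_< gap x y) (sym (weight-empty n)) pos))

  polynomial-parity : ∀ {c : Poly n} {d} → PolyDegLe c d → ∀ (x y : Cube n) → d < gap x y →
    parity (evalPoly c) (interval x y) ≡ false
  polynomial-parity {n} {c} deg x y lt = begin
    parity (evalPoly c) (interval x y)                         ≡⟨ parity-swap term (allCube n) (interval x y) ⟩
    parity (λ S → parity (term S) (interval x y)) (allCube n)  ≡⟨ parity-cong vanish (allCube n) ⟩
    parity (λ _ → false) (allCube n)                           ≡⟨ parity-false (allCube n) ⟩
    false                                                      ∎
    where
    open ≡-Reasoning
    term : Cube n → Cube n → Bool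
    term S w = c S ∧ subsetᵇ S w
    vanish : ∀ S → parity (term S) (interval x y) ≡ false
    vanish S with c S in present
    ... | false = parity-false (interval x y)
    ... | true  = monomial-parity S x y (≤-<-trans (deg S present) lt)

  low-degree-parity : ∀ {f : BoolFun n} {d} → Deg₂Le f d → ∀ b (x y : Cube n) → d < gap x y →
    parity (λ w → f w ≠ᵇ b) (interval x y) ≡ false
  low-degree-parity {f = f} (c , represents , deg) b x y lt = begin
    parity (λ w → f w ≠ᵇ b) (interval x y)
      ≡⟨ parity-xor f (λ _ → b) (interval x y) ⟩
    parity f (interval x y) xor parity (λ _ → b) (interval x y)
      ≡⟨ cong₂ _xor_ f-vanishes (constant-parity b x y (≤-<-trans z≤n lt)) ⟩
    false
      ∎
    where
    open ≡-Reasoning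
    f-vanishes : parity f (interval x y) ≡ false
    f-vanishes = trans (parity-cong (sym ∘ represents) (interval x y)) (polynomial-parity deg x y lt)

  module LowDegree {n} {f : BoolFun n} {d : ℕ} (deg : Deg₂Le f d) where

    -- On an interval [y, t] of dimension > d whose ends disagree, some point other than y
    -- disagrees with t: by parity, f ≠ f(t) holds at an even number of points of [y, t].
    witness-above : ∀ {y t : Cube n} → y ⊑ t → d < gap y t → f y ≢ f t →
      ∃ λ w → y ⊑ w × w ⊑ t × y ≢ w × f w ≢ f t
    witness-above {y} {t} yt big ne with interval-head yt
    ... | rest , eq , distinct with odd-witness (All.zip (inside , distinct)) odd
      where
      h : Cube n → Bool
      h w = f w ≠ᵇ f t
      inside : All (λ w → y ⊑ w × w ⊑ t) rest
      inside = All.tail (subst (All _) eq (interval-⊑ y t))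
      vanishes : h y xor parity h rest ≡ false
      vanishes = subst (λ L → parity h L ≡ false) eq (low-degree-parity deg (f t) y t big)
      odd : parity h rest ≡ true
      odd = trans (sym (xor≡false⇒≡ _ _ vanishes)) (≢⇒≠ᵇ _ _ ne)
    ... | w , ((yw , wt) , y≢w) , hw = w , yw , wt , y≢w , ≠ᵇ⇒≢ _ _ hw

    witness-below : ∀ {b y : Cube n} → b ⊑ y → d < gap b y → f y ≢ f b →
      ∃ λ w → b ⊑ w × w ⊑ y × w ≢ y × f w ≢ f b
    witness-below {b} {y} by big ne with interval-last by
    ... | ini , eq , distinct with odd-witness (All.zip (inside , distinct)) odd
      where
      h : Cube n → Bool
      h w = f w ≠ᵇ f b
      inside : All (λ w → b ⊑ w × w ⊑ y) ini
      inside = ++⁻ˡ ini (subst (All _) eq (interval-⊑ b y))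
      vanishes : parity h ini xor (h y xor false) ≡ false
      vanishes = trans (sym (parity-++ h ini [ y ]))
                       (subst (λ L → parity h L ≡ false) eq (low-degree-parity deg (f b) b y big))
      odd : parity h ini ≡ true
      odd = trans (xor≡false⇒≡ _ _ vanishes) (trans (xor-identityʳ (h y)) (≢⇒≠ᵇ _ _ ne))
    ... | w , ((bw , wy) , w≢y) , hw = w , bw , wy , w≢y , ≠ᵇ⇒≢ _ _ hw

    near-top : ∀ k {y t : Cube n} → y ⊑ t → gap y t ≤ k → f y ≢ f t →
      ∃ λ B → y ⊑ B × B ⊑ t × f B ≢ f t × gap B t ≤ d
    near-top zero    yt small ne = _ , ⊑-refl , yt , ne , ≤-trans small z≤n
    near-top (suc k) {y} {t} yt small ne with gap y t ≤? d
    ... | yes close = y , ⊑-refl , yt , ne , close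
    ... | no far with witness-above yt (≰⇒> far) ne
    ...   | w , yw , wt , y≢w , ne′ with near-top k wt (gap-drop-lower yw wt y≢w small) ne′
    ...     | B , wB , Bt , neB , close = B , ⊑-trans yw wB , Bt , neB , close

    near-bottom : ∀ k {b y : Cube n} → b ⊑ y → gap b y ≤ k → f y ≢ f b →
      ∃ λ B → b ⊑ B × B ⊑ y × f B ≢ f b × gap b B ≤ d
    near-bottom zero    by small ne = _ , by , ⊑-refl , ne , ≤-trans small z≤n
    near-bottom (suc k) {b} {y} by small ne with gap b y ≤? d
    ... | yes close = y , by , ⊑-refl , ne , close
    ... | no far with witness-below by (≰⇒> far) ne
    ...   | w , bw , wy , w≢y , ne′ with near-bottom k bw (gap-drop-upper bw wy w≢y small) ne′
    ...     | B , bB , Bw , neB , close = B , bB , ⊑-trans Bw wy , neB , close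

    Certified : Cube n → Cube n → Set
    Certified u v = ∃₂ λ k (w : Walk u v k) → gap u v ≤ d * changes f w

    flat : ∀ {u v : Cube n} → u ⊑ v → gap u v ≤ 0 → Certified u v
    flat uv g0 = let k , w = walk uv in k , w , ≤-trans g0 z≤n

    short : ∀ {u v : Cube n} → u ⊑ v → gap u v ≤ d → f u ≢ f v → Certified u v
    short uv close ne = let k , w = walk uv in k , w , ≤-trans close (d≤d*c (changes-pos f w ne))
      where
      d≤d*c : ∀ {c} → 1 ≤ c → d ≤ d * c
      d≤d*c pos = ≤-trans (≤-reflexive (sym (*-identityʳ d))) (*-monoʳ-≤ d pos)

    glue : ∀ {u m v : Cube n} → Certified u m → Certified m v → Certified u v
    glue {u} {m} {v} (k₁ , w₁ , p₁) (k₂ , w₂ , p₂) = k₁ + k₂ , w₁ ++ʷ w₂ , (begin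
      gap u v                             ≡⟨ gap-trans (walk-⊑ w₁) (walk-⊑ w₂) ⟩
      gap u m + gap m v                   ≤⟨ +-mono-≤ p₁ p₂ ⟩
      d * changes f w₁ + d * changes f w₂ ≡⟨ sym (*-distribˡ-+ d _ _) ⟩
      d * (changes f w₁ + changes f w₂)   ≡⟨ cong (d *_) (sym (changes-++ f w₁ w₂)) ⟩
      d * changes f (w₁ ++ʷ w₂)           ∎)
      where open ≤-Reasoning

    start-up : ∀ {z t : Cube n} → z ⊑ t → UpSensitive f z t → z ≡ t ⊎ ∃ λ y → z ⊑ y × y ⊑ t × f y ≢ f t
    start-up {z} {t} zt sens with f z Bool.≟ f t
    ... | no ne = inj₂ (z , ⊑-refl , zt , ne)
    ... | yes eq with cover-above zt
    ...   | inj₁ z≡t            = inj₁ z≡t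
    ...   | inj₂ (y , zy , yt) = inj₂ (y , ⋖⇒⊑ zy , yt , λ e → sens zy yt (trans e (sym eq)))

    start-down : ∀ {b x : Cube n} → b ⊑ x → DownSensitive f b x → b ≡ x ⊎ ∃ λ y → b ⊑ y × y ⊑ x × f y ≢ f b
    start-down {b} {x} bx sens with f x Bool.≟ f b
    ... | no ne = inj₂ (x , bx , ⊑-refl , ne)
    ... | yes eq with cover-below bx
    ...   | inj₁ b≡x            = inj₁ b≡x
    ...   | inj₂ (y , by , yx) = inj₂ (y , by , ⋖⇒⊑ yx , λ e → sens yx by (trans e (sym eq)))

    -- Main lemma, upward: if z is up-sensitive in [z, t] then [z, t] is certified.  Cut off a
    -- top segment [B, t] of length ≤ d with f(B) ≠ f(t) and recurse on [z, B].
    climb : ∀ k {z t : Cube n} → z ⊑ t → gap z t ≤ k → UpSensitive f z t → Certified z t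
    climb zero    zt small _ = flat zt small
    climb (suc k) {z} {t} zt small sens with start-up zt sens
    ... | inj₁ refl = flat zt (≤-reflexive (gap-refl z))
    ... | inj₂ (y , zy , yt , ne) with near-top (gap y t) yt ≤-refl ne
    ...   | B , yB , Bt , neB , close =
      glue (climb k zB (gap-drop-upper zB Bt (neB ∘ cong f) small) (λ c yB′ → sens c (⊑-trans yB′ Bt)))
           (short Bt close neB)
      where
      zB : z ⊑ B
      zB = ⊑-trans zy yB

    descend : ∀ k {b x : Cube n} → b ⊑ x → gap b x ≤ k → DownSensitive f b x → Certified b x
    descend zero    bx small _ = flat bx small
    descend (suc k) {b} {x} bx small sens with start-down bx sens
    ... | inj₁ refl = flat bx (≤-reflexive (gap-refl b))
    ... | inj₂ (y , by , yx , ne) with near-bottom (gap b y) by ≤-refl ne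
    ...   | B , bB , By , neB , close =
      glue (short bB close (neB ∘ sym))
           (descend k Bx (gap-drop-lower bB Bx (neB ∘ cong f ∘ sym) small)
                         (λ c By′ → sens c (⊑-trans bB By′)))
      where
      Bx : B ⊑ x
      Bx = ⊑-trans By yx

    sensitivity-≤ : ∀ {a} → ((ch : Chain n) → alternations f ch ≤ a) → ∀ x → sensitivity f x ≤ d * a
    sensitivity-≤ {a} maxAlt x
      with glue (descend _ (down-⊑ f x) ≤-refl (down-sensitive f x))
                (climb _ (⊑-up f x) ≤-refl (up-sensitive f x))
    ... | _ , w , certified = begin
      sensitivity f x                     ≡⟨ sensitivity-split f x ⟩
      gap (down f x) x + gap x (up f x)   ≡⟨ sym (gap-trans (down-⊑ f x) (⊑-up f x)) ⟩
      gap (down f x) (up f x)             ≤⟨ certified ⟩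
      d * changes f w                     ≤⟨ *-monoʳ-≤ d (changes-≤-alt f maxAlt w) ⟩
      d * a                               ∎
      where open ≤-Reasoning

  sum-≤ : ∀ {A : Set} (g : A → ℕ) {B} → (∀ a → g a ≤ B) → ∀ L → sum (map g L) ≤ length L * B
  sum-≤ g bound []      = z≤n
  sum-≤ g bound (a ∷ L) = +-mono-≤ (bound a) (sum-≤ g bound L)

  length-allCube : ∀ n → length (allCube n) ≡ 2 ^ n
  length-allCube zero    = refl
  length-allCube (suc n) = begin
    length (map (false ∷_) C ++ map (true ∷_) C)         ≡⟨ length-++ (map (false ∷_) C) ⟩
    length (map (false ∷_) C) + length (map (true ∷_) C) ≡⟨ cong₂ _+_ (length-map _ C) (length-map _ C) ⟩
    length C + length C                                  ≡⟨ cong (λ m → m + m) (length-allCube n) ⟩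
    2 ^ n + 2 ^ n                                        ≡⟨ cong (_+_ (2 ^ n)) (sym (+-identityʳ (2 ^ n))) ⟩
    2 ^ suc n                                            ∎
    where
    open ≡-Reasoning
    C : List (Cube n)
    C = allCube n

  d*a≤a*d² : ∀ d a → d * a ≤ a * d ^ 2
  d*a≤a*d² zero        a = z≤n
  d*a≤a*d² d@(suc _) a = begin
    d * a         ≤⟨ *-monoˡ-≤ a (m≤m*n d d) ⟩
    d * d * a     ≡⟨ *-comm (d * d) a ⟩
    a * (d * d)   ≡⟨ cong (λ m → a * (d * m)) (sym (*-identityʳ d)) ⟩
    a * d ^ 2     ∎
    where open ≤-Reasoning

  total-sensitivity-≤ : ∀ {f : BoolFun n} {a d} → Deg₂Le f d →
    ((ch : Chain n) → alternations f ch ≤ a) → totalSensitivity f ≤ 2 ^ n * (a * d ^ 2)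
  total-sensitivity-≤ {n} {f} {a} {d} deg maxAlt = begin
    totalSensitivity f                   ≤⟨ sum-≤ (sensitivity f) pointwise (allCube n) ⟩
    length (allCube n) * (a * d ^ 2)     ≡⟨ cong (_* (a * d ^ 2)) (length-allCube n) ⟩
    2 ^ n * (a * d ^ 2)                  ∎
    where
    open ≤-Reasoning
    pointwise : ∀ x → sensitivity f x ≤ a * d ^ 2
    pointwise x = ≤-trans (LowDegree.sensitivity-≤ deg maxAlt x) (d*a≤a*d² d a)

  -- T / q ≤ M as rationals whenever T ≤ q · M: both sides are normalisations of unnormalised
  -- fractions, which compare by cross-multiplication T · 1 ≤ M · q.
  ratio-≤ : ∀ T M q .{{_ : NonZero q}} → T ≤ q * M → (+ T) ℚ./ q ℚ.≤ (+ M) ℚ./ 1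
  ratio-≤ T M q@(suc k) T≤qM = ℚ.toℚᵘ-cancel-≤
    (ℚᵘ.≤-respˡ-≃ (ℚᵘ.≃-sym (ℚ.toℚᵘ-fromℚᵘ (ℚᵘ.mkℚᵘ (+ T) k)))
      (ℚᵘ.≤-respʳ-≃ (ℚᵘ.≃-sym (ℚ.toℚᵘ-fromℚᵘ (ℚᵘ.mkℚᵘ (+ M) 0)))
        (ℚᵘ.*≤* (subst₂ ℤ._≤_ (ℤ.pos-* T 1) (ℤ.pos-* M q)
          (ℤ.+≤+ (subst₂ _≤_ (sym (*-identityʳ T)) (*-comm q M) T≤qM))))))

open SensitivityBound using (total-sensitivity-≤; ratio-≤)
open import Data.Rational using (_≤_; _/_)

proposition17 : (n : ℕ) (f : BoolFun n) (a d : ℕ) → IsAlt f a → IsDeg₂ f d →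
    influence f ≤ (+ (a * d ^ 2)) / 1
proposition17 n f a d (_ , maxAlt) (deg , _) =
  ratio-≤ (totalSensitivity f) (a * d ^ 2) (2 ^ n) {{m^n≢0 2 n}} (total-sensitivity-≤ deg maxAlt)
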